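{- Let $D\ge2$, $N\in\{2D,2D+1\}$, and let $\Gamma$, $\Lambda$, $E_0^{*(r)}$ and $P_{h,i,j}$ be as in the context. Then: - $\{P_{0,i,i}: i\in\{0,\dots,D\}\}$ is a basis of $E_0^{*(1)}\Lambda$; - $\{P_{i,0,i}: i\in\{0,\dots,D\}\}$ is a basis of $E_0^{*(2)}\Lambda$; - $\{P_{i,i,0}: i\in\{0,\dots,D\}\}$ is a basis of $E_0^{*(3)}\Lambda$.
   Context: $\Gamma$ is the cycle graph on $X=\{0,\dots,N-1\}=\mathbb{Z}/N\mathbb{Z}$, with $x\sim y$ iff $x-y\equiv\pm1 \pmod N$. Its distance is $\partial(x,y)=\min\{r,N-r\}$ with $r\equiv x-y \pmod N$, $0\le r<N$, and its diameter is $D$. Fix a primitive $N$-th root of unity $\zeta$ and set $\theta^*_i=\zeta^i+\zeta^{ -i}$. $V$ has orthonormal basis $X$ and $A_1x=(x-1)+(x+1)$. On $V^{\otimes3}$: - $A^{(1)}=A_1\otimes I\otimes I$, $A^{(2)}=I\otimes A_1\otimes I$, $A^{(3)}=I\otimes I\otimes A_1$; - $A^{*(1)},A^{*(2)},A^{*(3)}$ multiply $x\otimes y\otimes z$ by $\theta^*_{\partial(y,z)}$, $\theta^*_{\partial(x,z)}$ and $\theta^*_{\partial(x,y)}$ respectively; - $E_0^{*(1)}$, $E_0^{*(2)}$, $E_0^{*(3)}$ map $x\otimes y\otimes z$ to itself if $y=z$ (respectively $x=z$, $x=y$), and to $0$ otherwise. $\Lambda$ (the fundamental module) is the smallest subspace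 containing $\mathbf 1^{\otimes3}=\sum_{x,y,z}x\otimes y\otimes z$ and invariant under the six maps $A^{(r)},A^{*(r)}$. $P_{h,i,j}=\sum x\otimes y\otimes z$, where the sum is over $x,y,z\in X$ with $\partial(y,z)=h$, $\partial(x,z)=i$ and $\partial(x,y)=j$. -}

module Defs where

open import Level using (Level; _⊔_)
open import Algebra.Bundles using (CommutativeRing)
import Data.Nat as ℕ
open import Data.Nat using (ℕ; zero; suc; _∸_; _⊓_; _≤ᵇ_; _<_; _≤_)
open import Data.Fin using (Fin; toℕ)
import Data.Fin as Fin
open import Data.Bool using (Bool; true; false; if_then_else_; _∧_)
open import Data.Product using (Σ; ∃; _×_; _,_)
open import Relation.Nullary using (¬_)
open import Relation.Binary.PropositionalEquality using (_≡_)

module _ {c ℓ : Level} (R : CommutativeRing c ℓ) where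
  open CommutativeRing R

  IsField : Set (c ⊔ ℓ)
  IsField = (¬ (0# ≈ 1#)) × (∀ (a : Carrier) → ¬ (a ≈ 0#) → Σ Carrier (λ b → (a * b) ≈ 1#))

  ℕ→R : ℕ → Carrier
  ℕ→R zero    = 0#
  ℕ→R (suc n) = 1# + ℕ→R n

  CharZero : Set ℓ
  CharZero = ∀ (n : ℕ) → ℕ→R n ≈ 0# → n ≡ 0

  pow : Carrier → ℕ → Carrier
  pow a zero    = 1#
  pow a (suc n) = a * pow a n

  IsPrimitiveRoot : ℕ → Carrier → Set ℓ
  IsPrimitiveRoot N ζ = (pow ζ N ≈ 1#) × (∀ (k : ℕ) → 0 < k → k < N → ¬ (pow ζ k ≈ 1#))

-- The cycle graph on X = Fin N = ℤ/Nℤ, the space V⊗V⊗V (as coefficient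
-- functions X³ → R w.r.t. the basis x⊗y⊗z), the fundamental module Λ.

module Cycle {c ℓ : Level} (R : CommutativeRing c ℓ) (N : ℕ) (ζ : CommutativeRing.Carrier R) where
  open CommutativeRing R

  X : Set
  X = Fin N

  residue : X → X → ℕ
  residue x y = if toℕ y ≤ᵇ toℕ x then toℕ x ∸ toℕ y else (N ℕ.+ toℕ x) ∸ toℕ y

  dist : X → X → ℕ
  dist x y = residue x y ⊓ (N ∸ residue x y)

  adjᵇ : X → X → Bool
  adjᵇ x y = (residue x y ℕ.≡ᵇ 1) Data.Bool.∨ (residue x y ℕ.≡ᵇ (N ∸ 1))

  -- θ*_i = ζ^i + ζ^{-i}, with ζ^{-i} = ζ^{N-i} for 0 ≤ i ≤ N
  θ* : ℕ → Carrier
  θ* i = pow R ζ i + pow R ζ (N ∸ i)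

  sumFin : (n : ℕ) → (Fin n → Carrier) → Carrier
  sumFin zero    f = 0#
  sumFin (suc n) f = f Fin.zero + sumFin n (λ i → f (Fin.suc i))

  ind : Bool → Carrier
  ind b = if b then 1# else 0#

  V³ : Set c
  V³ = X → X → X → Carrier

  _≋_ : V³ → V³ → Set ℓ
  u ≋ v = ∀ x y z → u x y z ≈ v x y z

  0v : V³
  0v _ _ _ = 0#

  𝟙³ : V³
  𝟙³ _ _ _ = 1#

  _+v_ : V³ → V³ → V³
  (u +v v) x y z = u x y z + v x y z

  _·v_ : Carrier → V³ → V³
  (a ·v v) x y z = a * v x y z

  -- A^{(r)}: A₁ acting on the r-th tensor factor; A₁ x' = Σ_{x ∼ x'} x,
  -- so the coefficient at x of A₁ f is Σ_{x' ∼ x} f(x').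
  A⁽¹⁾ A⁽²⁾ A⁽³⁾ : V³ → V³
  A⁽¹⁾ v x y z = sumFin N (λ x' → ind (adjᵇ x x') * v x' y z)
  A⁽²⁾ v x y z = sumFin N (λ y' → ind (adjᵇ y y') * v x y' z)
  A⁽³⁾ v x y z = sumFin N (λ z' → ind (adjᵇ z z') * v x y z')

  A*⁽¹⁾ A*⁽²⁾ A*⁽³⁾ : V³ → V³
  A*⁽¹⁾ v x y z = θ* (dist y z) * v x y z
  A*⁽²⁾ v x y z = θ* (dist x z) * v x y z
  A*⁽³⁾ v x y z = θ* (dist x y) * v x y z

  E₀*⁽¹⁾ E₀*⁽²⁾ E₀*⁽³⁾ : V³ → V³
  E₀*⁽¹⁾ v x y z = ind (toℕ y ℕ.≡ᵇ toℕ z) * v x y z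
  E₀*⁽²⁾ v x y z = ind (toℕ x ℕ.≡ᵇ toℕ z) * v x y z
  E₀*⁽³⁾ v x y z = ind (toℕ x ℕ.≡ᵇ toℕ y) * v x y z

  -- Λ: the smallest subspace containing 𝟙⊗𝟙⊗𝟙 and invariant under the
  -- six maps (inductively generated, hence least).
  data Λ : V³ → Set (c ⊔ ℓ) where
    gen    : Λ 𝟙³
    zeroΛ  : Λ 0v
    addΛ   : ∀ {u v} → Λ u → Λ v → Λ (u +v v)
    scaleΛ : ∀ (a : Carrier) {v} → Λ v → Λ (a ·v v)
    A1 : ∀ {v} → Λ v → Λ (A⁽¹⁾ v)
    A2 : ∀ {v} → Λ v → Λ (A⁽²⁾ v)
    A3 : ∀ {v} → Λ v → Λ (A⁽³⁾ v)
    A*1 : ∀ {v} → Λ v → Λ (A*⁽¹⁾ v)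
    A*2 : ∀ {v} → Λ v → Λ (A*⁽²⁾ v)
    A*3 : ∀ {v} → Λ v → Λ (A*⁽³⁾ v)
    respΛ : ∀ {u v} → u ≋ v → Λ u → Λ v

  imageΛ : (V³ → V³) → V³ → Set (c ⊔ ℓ)
  imageΛ E w = Σ V³ (λ u → Λ u × (w ≋ E u))

  P : ℕ → ℕ → ℕ → V³
  P h i j x y z = ind ((dist y z ℕ.≡ᵇ h) ∧ (dist x z ℕ.≡ᵇ i) ∧ (dist x y ℕ.≡ᵇ j))

  lincomb : (m : ℕ) → (Fin m → Carrier) → (Fin m → V³) → V³
  lincomb m a b x y z = sumFin m (λ k → a k * b k x y z)

  IsBasis : ∀ {s} → (V³ → Set s) → (m : ℕ) → (Fin m → V³) → Set (c ⊔ ℓ ⊔ s)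
  IsBasis S m b =
    (∀ k → S (b k))
    × (∀ (a : Fin m → Carrier) → lincomb m a b ≋ 0v → ∀ k → a k ≈ 0#)
    × (∀ w → S w → Σ (Fin m → Carrier) (λ a → w ≋ lincomb m a b))

-- Every vector of Λ is invariant under the reflections x ↦ c − x of the cycle, applied to all
-- three tensor factors at once: they are automorphisms of Γ, so they commute with the A^(r) and
-- preserve every distance. A reflection-invariant function of two vertices depends only on their
-- distance, so on the diagonal y = z every vector of Λ is a function of ∂(x,y) alone, and
-- E₀^*(1)Λ lies in the span of the P_{0,i,i}, whose supports are disjoint. Conversely
-- P_{0,i,i} = E₀^*(1) T_i, where T_i is the indicator of ∂(x,y) = i. Since ζ is primitive and
-- 2D ≤ N, the values θ*_0, …, θ*_D are pairwise distinct, so Lagrange interpolation writes T_i as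
-- a polynomial in A^*(3) applied to 1⊗1⊗1, and T_i ∈ Λ. The other two projections are handled
-- the same way with the tensor factors permuted.

module Submission where

open import Defs
open import Level using (Level; 0ℓ; _⊔_)
open import Algebra.Bundles using (CommutativeRing)
open import Data.Bool using (Bool; true; false; T; _∧_; _∨_)
open import Data.Bool.Properties using (∨-comm; ∧-idem; ∧-zeroʳ; ∧-identityʳ)
open import Data.Fin as Fin using (Fin; toℕ; fromℕ<; inject≤)
open import Data.Fin.Permutation using (Permutation′; permutation)
open import Data.Fin.Properties using (toℕ-injective; toℕ<n; toℕ-fromℕ<; toℕ-inject≤)
open import Data.List using (List; []; _∷_; map; filter; upTo)
open import Data.List.Membership.Propositional using (_∈_)
open import Data.List.Membership.Propositional.Properties
  using (∈-map⁺; ∈-map⁻; ∈-filter⁺; ∈-filter⁻; ∈-upTo⁺; ∈-upTo⁻)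
open import Data.List.Relation.Unary.Any using (here; there)
open import Data.Nat as ℕ
  using (ℕ; zero; suc; _∸_; _⊓_; _≤_; _<_; _≤ᵇ_; _≡ᵇ_; z≤n; s≤s; z<s; NonZero)
import Data.Nat.Properties as ℕₚ
open import Data.Nat.DivMod using (_%_; [m+kn]%n≡m%n; m<n⇒m%n≡m)
open import Data.Product using (Σ; ∃₂; _×_; _,_; proj₁; proj₂)
open import Data.Sum using (_⊎_; inj₁; inj₂)
open import Data.Unit using (tt)
open import Function using (_∘_; mk⇔)
open import Relation.Binary.Bundles using (Setoid)
open import Relation.Binary.Definitions using (tri<; tri≈; tri>)
import Relation.Binary.Reasoning.Setoid
import Relation.Binary.PropositionalEquality as ≡
open ≡ using (_≡_; _≢_)
open import Relation.Nullary using (¬_; Dec; yes; no; ¬?; contradiction)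
open import Relation.Nullary.Decidable using (dec-true; dec-false; does-⇔)

≡ᵇ-refl : ∀ m → (m ≡ᵇ m) ≡ true
≡ᵇ-refl m = dec-true (m ℕₚ.≟ m) ≡.refl

≢⇒≡ᵇ-false : ∀ {m n} → m ≢ n → (m ≡ᵇ n) ≡ false
≢⇒≡ᵇ-false {m} {n} = dec-false (m ℕₚ.≟ n)

toℕ≡ᵇ-true⇒≡ : ∀ {m} {x y : Fin m} → (toℕ x ≡ᵇ toℕ y) ≡ true → x ≡ y
toℕ≡ᵇ-true⇒≡ {x = x} {y} eq =
  toℕ-injective (ℕₚ.≡ᵇ⇒≡ (toℕ x) (toℕ y) (≡.subst T (≡.sym eq) tt))

≢⇒toℕ≡ᵇ-false : ∀ {m} {x y : Fin m} → x ≢ y → (toℕ x ≡ᵇ toℕ y) ≡ false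
≢⇒toℕ≡ᵇ-false x≢y = ≢⇒≡ᵇ-false (x≢y ∘ toℕ-injective)

m+m≤1+n⇒m≤n : ∀ m {n} → m ℕ.+ m ≤ suc n → m ≤ n
m+m≤1+n⇒m≤n zero    _         = z≤n
m+m≤1+n⇒m≤n (suc m) (s≤s 2m≤n) = ℕₚ.m+n≤o⇒n≤o m 2m≤n

module Modular (N : ℕ) where
  open import Data.Nat.Base using (_+_; _*_)
  open import Algebra.Properties.CommutativeSemigroup ℕₚ.+-commutativeSemigroup
    using (interchange; xy∙z≈xz∙y)
  open ≡

  infix 4 _≡ₘ_
  _≡ₘ_ : ℕ → ℕ → Set
  a ≡ₘ b = ∃₂ λ k l → a + k * N ≡ b + l * N

  private
    spread : ∀ a b k l → (a + b) + (k + l) * N ≡ (a + k * N) + (b + l * N)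
    spread a b k l = trans (cong ((a + b) +_) (ℕₚ.*-distribʳ-+ N k l)) (interchange a b (k * N) (l * N))

  ≡⇒≡ₘ : ∀ {a b} → a ≡ b → a ≡ₘ b
  ≡⇒≡ₘ refl = 0 , 0 , refl

  ≡ₘ-refl : ∀ {a} → a ≡ₘ a
  ≡ₘ-refl = ≡⇒≡ₘ refl

  ≡ₘ-sym : ∀ {a b} → a ≡ₘ b → b ≡ₘ a
  ≡ₘ-sym (k , l , eq) = l , k , sym eq

  +-cong-≡ₘ : ∀ {a b c d} → a ≡ₘ b → c ≡ₘ d → a + c ≡ₘ b + d
  +-cong-≡ₘ {a} {b} {c} {d} (k , l , eq) (k′ , l′ , eq′) = k + k′ , l + l′ ,
    trans (spread a c k k′) (trans (cong₂ _+_ eq eq′) (sym (spread b d l l′)))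

  +-cancelʳ-≡ₘ : ∀ {a b} c → a + c ≡ₘ b + c → a ≡ₘ b
  +-cancelʳ-≡ₘ {a} {b} c (k , l , eq) = k , l ,
    ℕₚ.+-cancelʳ-≡ c _ _
      (trans (sym (xy∙z≈xz∙y a c (k * N))) (trans eq (xy∙z≈xz∙y b c (l * N))))

  ≡ₘ-trans : ∀ {a b c} → a ≡ₘ b → b ≡ₘ c → a ≡ₘ c
  ≡ₘ-trans {a} {b} {c} p q = +-cancelʳ-≡ₘ b (subst (a + b ≡ₘ_) (ℕₚ.+-comm b c) (+-cong-≡ₘ p q))

  ≡ₘ-setoid : Setoid 0ℓ 0ℓ
  ≡ₘ-setoid = record
    { _≈_ = _≡ₘ_
    ; isEquivalence = record { refl = ≡ₘ-refl ; sym = ≡ₘ-sym ; trans = ≡ₘ-trans }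
    }

  module ≡ₘ-Reasoning = Relation.Binary.Reasoning.Setoid ≡ₘ-setoid

  N≡ₘ0 : N ≡ₘ 0
  N≡ₘ0 = 0 , 1 , refl

  ≡ₘ⇒≡ : .{{_ : NonZero N}} → ∀ {a b} → a < N → b < N → a ≡ₘ b → a ≡ b
  ≡ₘ⇒≡ {a} {b} a<N b<N (k , l , eq) = begin
      a               ≡⟨ sym (m<n⇒m%n≡m a<N) ⟩
      a % N           ≡⟨ sym ([m+kn]%n≡m%n a k N) ⟩
      (a + k * N) % N ≡⟨ cong (_% N) eq ⟩
      (b + l * N) % N ≡⟨ [m+kn]%n≡m%n b l N ⟩
      b % N           ≡⟨ m<n⇒m%n≡m b<N ⟩
      b               ∎
    where open ≡-Reasoning

-- The combinatorics of Cycle R N ζ does not involve R or ζ; they are parameters only because Defs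
-- bundles the graph and the fundamental module in one module.
module CycleArithmetic {ℓ₁ ℓ₂ : Level} (R : CommutativeRing ℓ₁ ℓ₂)
                       (n : ℕ) (ζ : CommutativeRing.Carrier R) where
  open Cycle R (suc n) ζ using (X; residue; dist; adjᵇ)
  open import Data.Nat.Base using (_+_)
  open import Algebra.Properties.CommutativeSemigroup ℕₚ.+-commutativeSemigroup using (interchange)
  open Modular (suc n)
  open ℕₚ
  open ≡

  N : ℕ
  N = suc n

  private
    toℕ≤N+toℕ : ∀ (x y : X) → toℕ y ≤ N + toℕ x
    toℕ≤N+toℕ x y = ≤-trans (<⇒≤ (toℕ<n y)) (m≤m+n N (toℕ x))

  residue+≡ₘ : ∀ x y → residue x y + toℕ y ≡ₘ toℕ x
  residue+≡ₘ x y with toℕ y ≤ᵇ toℕ x in y≤ᵇx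
  ... | true  = ≡⇒≡ₘ (m∸n+n≡m (≤ᵇ⇒≤ (toℕ y) (toℕ x) (subst T (sym y≤ᵇx) tt)))
  ... | false = ≡ₘ-trans (≡⇒≡ₘ (m∸n+n≡m (toℕ≤N+toℕ x y))) (+-cong-≡ₘ N≡ₘ0 ≡ₘ-refl)

  residue<N : ∀ x y → residue x y < N
  residue<N x y with toℕ y ≤ᵇ toℕ x in y≤ᵇx
  ... | true  = ≤-<-trans (m∸n≤m (toℕ x) (toℕ y)) (toℕ<n x)
  ... | false = subst (N + toℕ x ∸ toℕ y <_) (m+n∸n≡m N (toℕ x)) (∸-monoʳ-< x<y (toℕ≤N+toℕ x y))
    where
      x<y : toℕ x < toℕ y
      x<y = ≰⇒> (λ y≤x → subst T y≤ᵇx (≤⇒≤ᵇ y≤x))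

  residue-unique : ∀ x y {r} → r < N → r + toℕ y ≡ₘ toℕ x → residue x y ≡ r
  residue-unique x y r<N r+y≡x =
    ≡ₘ⇒≡ (residue<N x y) r<N (+-cancelʳ-≡ₘ (toℕ y) (≡ₘ-trans (residue+≡ₘ x y) (≡ₘ-sym r+y≡x)))

  residue-refl : ∀ x → residue x x ≡ 0
  residue-refl x = residue-unique x x z<s ≡ₘ-refl

  residue≡0⇒≡ : ∀ {x y} → residue x y ≡ 0 → x ≡ y
  residue≡0⇒≡ {x} {y} r≡0 = toℕ-injective (sym (≡ₘ⇒≡ (toℕ<n y) (toℕ<n x)
    (≡ₘ-trans (≡⇒≡ₘ (cong (_+ toℕ y) (sym r≡0))) (residue+≡ₘ x y))))

  residue-swap : ∀ {x y} → x ≢ y → residue y x ≡ N ∸ residue x y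
  residue-swap {x} {y} x≢y = residue-unique y x N∸r<N (begin
      N ∸ r + toℕ x         ≈⟨ +-cong-≡ₘ ≡ₘ-refl (≡ₘ-sym (residue+≡ₘ x y)) ⟩
      N ∸ r + (r + toℕ y)   ≡⟨ sym (+-assoc (N ∸ r) r (toℕ y)) ⟩
      (N ∸ r + r) + toℕ y   ≡⟨ cong (_+ toℕ y) (m∸n+n≡m (<⇒≤ (residue<N x y))) ⟩
      N + toℕ y             ≈⟨ +-cong-≡ₘ N≡ₘ0 ≡ₘ-refl ⟩
      toℕ y                 ∎)
    where
      open ≡ₘ-Reasoning
      r = residue x y
      N∸r<N : N ∸ r < N
      N∸r<N = ∸-monoʳ-< (n≢0⇒n>0 (x≢y ∘ residue≡0⇒≡)) (<⇒≤ (residue<N x y))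

  residue-zeroʳ : ∀ x → residue x Fin.zero ≡ toℕ x
  residue-zeroʳ x = residue-unique x Fin.zero (toℕ<n x) (≡⇒≡ₘ (+-identityʳ (toℕ x)))

  reflect : X → X → X
  reflect c x = fromℕ< (residue<N c x)

  toℕ-reflect : ∀ c x → toℕ (reflect c x) ≡ residue c x
  toℕ-reflect c x = toℕ-fromℕ< (residue<N c x)

  reflect+≡ₘ : ∀ c x → toℕ (reflect c x) + toℕ x ≡ₘ toℕ c
  reflect+≡ₘ c x = subst (λ r → r + toℕ x ≡ₘ toℕ c) (sym (toℕ-reflect c x)) (residue+≡ₘ c x)

  reflect-involutive : ∀ c x → reflect c (reflect c x) ≡ x
  reflect-involutive c x = toℕ-injective (trans (toℕ-reflect c (reflect c x))
    (residue-unique c (reflect c x) (toℕ<n x)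
      (subst (_≡ₘ toℕ c) (+-comm _ (toℕ x)) (reflect+≡ₘ c x))))

  reflect-self : ∀ x → reflect x x ≡ Fin.zero
  reflect-self x = toℕ-injective (trans (toℕ-reflect x x) (residue-refl x))

  toℕ-reflect-zero : ∀ {x} → x ≢ Fin.zero → toℕ (reflect Fin.zero x) ≡ N ∸ toℕ x
  toℕ-reflect-zero {x} x≢0 =
    trans (toℕ-reflect Fin.zero x) (trans (residue-swap x≢0) (cong (N ∸_) (residue-zeroʳ x)))

  residue-reflect : ∀ c x y → residue (reflect c x) (reflect c y) ≡ residue y x
  residue-reflect c x y = residue-unique (reflect c x) (reflect c y) (residue<N y x)
    (+-cancelʳ-≡ₘ (toℕ x + toℕ y) (begin
      (r + σy) + (toℕ x + toℕ y) ≡⟨ interchange r σy (toℕ x) (toℕ y) ⟩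
      (r + toℕ x) + (σy + toℕ y) ≈⟨ +-cong-≡ₘ (residue+≡ₘ y x) (reflect+≡ₘ c y) ⟩
      toℕ y + toℕ c              ≡⟨ +-comm (toℕ y) (toℕ c) ⟩
      toℕ c + toℕ y              ≈⟨ +-cong-≡ₘ (≡ₘ-sym (reflect+≡ₘ c x)) ≡ₘ-refl ⟩
      (σx + toℕ x) + toℕ y       ≡⟨ +-assoc σx (toℕ x) (toℕ y) ⟩
      σx + (toℕ x + toℕ y)       ∎))
    where
      open ≡ₘ-Reasoning
      r = residue y x
      σx = toℕ (reflect c x)
      σy = toℕ (reflect c y)

  FlipInvariant : ∀ {a} {A : Set a} → (ℕ → A) → Set a
  FlipInvariant F = ∀ r → r ≤ N → F (N ∸ r) ≡ F r

  module _ {a} {A : Set a} {F : ℕ → A} (F-flip : FlipInvariant F) where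

    flipInvariant-swap : ∀ x y → F (residue y x) ≡ F (residue x y)
    flipInvariant-swap x y with x Fin.≟ y
    ... | yes refl = refl
    ... | no x≢y   = trans (cong F (residue-swap x≢y)) (F-flip (residue x y) (<⇒≤ (residue<N x y)))

    flipInvariant-reflect : ∀ c x y → F (residue (reflect c x) (reflect c y)) ≡ F (residue x y)
    flipInvariant-reflect c x y = trans (cong F (residue-reflect c x y)) (flipInvariant-swap x y)

  ∸-≡ᵇ-∸ : ∀ {a b} → a ≤ N → b ≤ N → (N ∸ a ≡ᵇ N ∸ b) ≡ (a ≡ᵇ b)
  ∸-≡ᵇ-∸ {a} {b} a≤N b≤N =
    does-⇔ (mk⇔ (∸-cancelˡ-≡ a≤N b≤N) (cong (N ∸_))) (N ∸ a ≟ N ∸ b) (a ≟ b)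

  dist-flipInvariant : FlipInvariant (λ r → r ⊓ (N ∸ r))
  dist-flipInvariant r r≤N = trans (cong ((N ∸ r) ⊓_) (m∸[m∸n]≡n r≤N)) (⊓-comm (N ∸ r) r)

  adj-flipInvariant : FlipInvariant (λ r → (r ≡ᵇ 1) ∨ (r ≡ᵇ n))
  adj-flipInvariant r r≤N = trans
    (cong₂ _∨_ (trans (cong (N ∸ r ≡ᵇ_) (sym (m+n∸n≡m 1 n))) (∸-≡ᵇ-∸ r≤N (n≤1+n n)))
               (∸-≡ᵇ-∸ r≤N (s≤s z≤n)))
    (∨-comm (r ≡ᵇ n) (r ≡ᵇ 1))

  dist-sym : ∀ x y → dist x y ≡ dist y x
  dist-sym x y = flipInvariant-swap dist-flipInvariant y x

  dist-reflect : ∀ c x y → dist (reflect c x) (reflect c y) ≡ dist x y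
  dist-reflect = flipInvariant-reflect dist-flipInvariant

  adj-reflect : ∀ c x y → adjᵇ (reflect c x) (reflect c y) ≡ adjᵇ x y
  adj-reflect = flipInvariant-reflect adj-flipInvariant

  dist-refl : ∀ x → dist x x ≡ 0
  dist-refl x = cong (λ r → r ⊓ (N ∸ r)) (residue-refl x)

  dist≡0⇒≡ : ∀ {x y} → dist x y ≡ 0 → x ≡ y
  dist≡0⇒≡ {x} {y} d≡0 with ≤-total (residue x y) (N ∸ residue x y)
  ... | inj₁ r≤N∸r = residue≡0⇒≡ (trans (sym (m≤n⇒m⊓n≡m r≤N∸r)) d≡0)
  ... | inj₂ N∸r≤r =
    contradiction (trans (sym (m≥n⇒m⊓n≡n N∸r≤r)) d≡0) (m>n⇒m∸n≢0 (residue<N x y))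

  dist≤ : ∀ {D} → N ≤ suc (D + D) → ∀ x y → dist x y ≤ D
  dist≤ {D} N≤2D+1 x y with residue x y ≤? D
  ... | yes r≤D = ≤-trans (m⊓n≤m _ _) r≤D
  ... | no  r≰D =
    ≤-trans (m⊓n≤n _ _) (m≤n+o⇒m∸n≤o N (residue x y) (≤-trans N≤2D+1 (+-monoˡ-≤ D (≰⇒> r≰D))))

  dist-zeroʳ : ∀ t → toℕ t + toℕ t ≤ N → dist t Fin.zero ≡ toℕ t
  dist-zeroʳ t 2t≤N =
    trans (cong (λ r → r ⊓ (N ∸ r)) (residue-zeroʳ t)) (m≤n⇒m⊓n≡m (m+n≤o⇒m≤o∸n (toℕ t) 2t≤N))

  ≢⇒dist≡ᵇ0-false : ∀ {x y} → x ≢ y → (dist x y ≡ᵇ 0) ≡ false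
  ≢⇒dist≡ᵇ0-false x≢y = ≢⇒≡ᵇ-false (x≢y ∘ dist≡0⇒≡)

module RingFacts {ℓ₁ ℓ₂ : Level} (R : CommutativeRing ℓ₁ ℓ₂) where
  open CommutativeRing R
  open import Algebra.Properties.Ring ring using (x[y-z]≈xy-xz; [y-z]x≈yx-zx)
  open import Algebra.Properties.AbelianGroup +-abelianGroup using (⁻¹-∙-comm)
  open import Algebra.Properties.Group +-group using (⁻¹-involutive)
  open import Algebra.Properties.CommutativeSemigroup +-commutativeSemigroup using (interchange)
  open import Relation.Binary.Reasoning.Setoid setoid

  vanishing : List Carrier → Carrier → Carrier
  vanishing []       t = 1#
  vanishing (r ∷ rs) t = (t - r) * vanishing rs t

  vanishing-root : ∀ {t rs} → t ∈ rs → vanishing rs t ≈ 0#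
  vanishing-root {t} (here ≡.refl) = trans (*-congʳ (-‿inverseʳ t)) (zeroˡ _)
  vanishing-root     (there t∈rs) = trans (*-congˡ (vanishing-root t∈rs)) (zeroʳ _)

  pow-+ : ∀ x m n → pow R x (m ℕ.+ n) ≈ pow R x m * pow R x n
  pow-+ x zero    n = sym (*-identityˡ _)
  pow-+ x (suc m) n = trans (*-congˡ (pow-+ x m n)) (sym (*-assoc _ _ _))

  [a-b][1-s]≈[a+sb]-[b+sa] : ∀ a b s → (a - b) * (1# - s) ≈ (a + s * b) - (b + s * a)
  [a-b][1-s]≈[a+sb]-[b+sa] a b s = begin
    (a - b) * (1# - s)                  ≈⟨ [y-z]x≈yx-zx (1# - s) a b ⟩
    a * (1# - s) - b * (1# - s)
      ≈⟨ +-cong (x[y-z]≈xy-xz a 1# s) (-‿cong (x[y-z]≈xy-xz b 1# s)) ⟩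
    (a * 1# - a * s) - (b * 1# - b * s)
      ≈⟨ +-cong (+-congʳ (*-identityʳ a)) (-‿cong (+-congʳ (*-identityʳ b))) ⟩
    (a - a * s) - (b - b * s)           ≈⟨ +-congˡ (sym (⁻¹-∙-comm b (- (b * s)))) ⟩
    (a - a * s) + (- b + - - (b * s))   ≈⟨ +-congˡ (+-congˡ (⁻¹-involutive (b * s))) ⟩
    (a - a * s) + (- b + b * s)         ≈⟨ +-congˡ (+-comm (- b) (b * s)) ⟩
    (a - a * s) + (b * s - b)           ≈⟨ interchange a (- (a * s)) (b * s) (- b) ⟩
    (a + b * s) + (- (a * s) - b)       ≈⟨ +-congˡ (+-comm (- (a * s)) (- b)) ⟩
    (a + b * s) + (- b + - (a * s))
      ≈⟨ +-cong (+-congˡ (*-comm b s)) (+-congˡ (-‿cong (*-comm a s))) ⟩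
    (a + s * b) + (- b + - (s * a))     ≈⟨ +-congˡ (⁻¹-∙-comm b (s * a)) ⟩
    (a + s * b) - (b + s * a)           ∎

module FieldFacts {ℓ₁ ℓ₂ : Level} (R : CommutativeRing ℓ₁ ℓ₂) (isField : IsField R) where
  open CommutativeRing R
  open RingFacts R using (vanishing)

  *-≉0 : ∀ {a b} → ¬ a ≈ 0# → ¬ b ≈ 0# → ¬ a * b ≈ 0#
  *-≉0 {a} {b} a≉0 b≉0 ab≈0 with proj₂ isField a a≉0
  ... | a⁻¹ , aa⁻¹≈1 = b≉0 (begin
    b                ≈⟨ sym (*-identityˡ b) ⟩
    1# * b           ≈⟨ *-congʳ (sym aa⁻¹≈1) ⟩
    (a * a⁻¹) * b    ≈⟨ *-congʳ (*-comm a a⁻¹) ⟩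
    (a⁻¹ * a) * b    ≈⟨ *-assoc a⁻¹ a b ⟩
    a⁻¹ * (a * b)    ≈⟨ *-congˡ ab≈0 ⟩
    a⁻¹ * 0#         ≈⟨ zeroʳ a⁻¹ ⟩
    0#               ∎)
    where open import Relation.Binary.Reasoning.Setoid setoid

  vanishing-≉0 : ∀ {t} rs → (∀ {r} → r ∈ rs → ¬ t - r ≈ 0#) → ¬ vanishing rs t ≈ 0#
  vanishing-≉0 []       _      1≈0 = proj₁ isField (sym 1≈0)
  vanishing-≉0 (r ∷ rs) t-r≉0 = *-≉0 (t-r≉0 (here ≡.refl)) (vanishing-≉0 rs (t-r≉0 ∘ there))

module FundamentalModule {ℓ₁ ℓ₂ : Level} (R : CommutativeRing ℓ₁ ℓ₂)
                         (n : ℕ) (ζ : CommutativeRing.Carrier R) where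
  open CommutativeRing R hiding (zero)
  open Cycle R (suc n) ζ
  open CycleArithmetic R n ζ
  open RingFacts R using (vanishing)
  open import Algebra.Properties.CommutativeMonoid.Sum +-commutativeMonoid using (sum; sum-permute)
  open import Relation.Binary.Reasoning.Setoid setoid

  sumFin≡sum : ∀ m (f : Fin m → Carrier) → sumFin m f ≡ sum f
  sumFin≡sum zero    f = ≡.refl
  sumFin≡sum (suc m) f = ≡.cong (f Fin.zero +_) (sumFin≡sum m (f ∘ Fin.suc))

  sumFin-cong : ∀ m {f g : Fin m → Carrier} → (∀ i → f i ≈ g i) → sumFin m f ≈ sumFin m g
  sumFin-cong zero    f≈g = refl
  sumFin-cong (suc m) f≈g = +-cong (f≈g Fin.zero) (sumFin-cong m (f≈g ∘ Fin.suc))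

  sumFin-zero : ∀ m {f : Fin m → Carrier} → (∀ i → f i ≈ 0#) → sumFin m f ≈ 0#
  sumFin-zero zero    f≈0 = refl
  sumFin-zero (suc m) f≈0 =
    trans (+-cong (f≈0 Fin.zero) (sumFin-zero m (f≈0 ∘ Fin.suc))) (+-identityˡ 0#)

  sumFin-δ : ∀ m (k : Fin m) (f : Fin m → Carrier) →
             sumFin m (λ j → f j * ind (toℕ k ≡ᵇ toℕ j)) ≈ f k
  sumFin-δ (suc m) Fin.zero    f =
    trans (+-cong (*-identityʳ _) (sumFin-zero m (λ j → zeroʳ _))) (+-identityʳ _)
  sumFin-δ (suc m) (Fin.suc k) f =
    trans (+-cong (zeroʳ _) (sumFin-δ m k (f ∘ Fin.suc))) (+-identityˡ _)

  lincomb-δ : ∀ {m} a (b : Fin m → V³) x y z k →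
              (∀ j → b j x y z ≈ ind (toℕ k ≡ᵇ toℕ j)) → lincomb m a b x y z ≈ a k
  lincomb-δ {m} a b x y z k b≈δ = trans (sumFin-cong m (λ j → *-congˡ (b≈δ j))) (sumFin-δ m k a)

  lincomb-zero : ∀ {m} a (b : Fin m → V³) x y z →
                 (∀ j → b j x y z ≈ 0#) → lincomb m a b x y z ≈ 0#
  lincomb-zero {m} a b x y z b≈0 = sumFin-zero m (λ j → trans (*-congˡ (b≈0 j)) (zeroʳ (a j)))

  sumFin-reflect : ∀ c (f : X → Carrier) → sumFin N (f ∘ reflect c) ≈ sumFin N f
  sumFin-reflect c f = begin
      sumFin N (f ∘ reflect c) ≡⟨ sumFin≡sum N (f ∘ reflect c) ⟩
      sum (f ∘ reflect c)      ≈⟨ sym (sum-permute f π) ⟩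
      sum f                    ≡⟨ ≡.sym (sumFin≡sum N f) ⟩
      sumFin N f               ∎
    where
      π : Permutation′ N
      π = permutation (reflect c) (reflect c) (reflect-involutive c) (reflect-involutive c)

  neighbourSum-reflect : ∀ c x (f g : X → Carrier) → (∀ x′ → f x′ ≈ g (reflect c x′)) →
    sumFin N (λ x′ → ind (adjᵇ x x′) * f x′) ≈
    sumFin N (λ x′ → ind (adjᵇ (reflect c x) x′) * g x′)
  neighbourSum-reflect c x f g f≈g∘σ = begin
      sumFin N (λ x′ → ind (adjᵇ x x′) * f x′)
    ≈⟨ sumFin-cong N (λ x′ → *-cong (reflexive (≡.cong ind (≡.sym (adj-reflect c x x′)))) (f≈g∘σ x′)) ⟩
      sumFin N (λ x′ → ind (adjᵇ (reflect c x) (reflect c x′)) * g (reflect c x′))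
    ≈⟨ sumFin-reflect c (λ x′ → ind (adjᵇ (reflect c x) x′) * g x′) ⟩
      sumFin N (λ x′ → ind (adjᵇ (reflect c x) x′) * g x′) ∎

  ReflectionInvariant : V³ → Set ℓ₂
  ReflectionInvariant u = ∀ c x y z → u x y z ≈ u (reflect c x) (reflect c y) (reflect c z)

  θ*-dist-reflect : ∀ c x y → θ* (dist x y) ≈ θ* (dist (reflect c x) (reflect c y))
  θ*-dist-reflect c x y = reflexive (≡.cong θ* (≡.sym (dist-reflect c x y)))

  Λ⇒reflectionInvariant : ∀ {u} → Λ u → ReflectionInvariant u
  Λ⇒reflectionInvariant gen           c x y z = refl
  Λ⇒reflectionInvariant zeroΛ         c x y z = refl
  Λ⇒reflectionInvariant (addΛ p q)    c x y z =
    +-cong (Λ⇒reflectionInvariant p c x y z) (Λ⇒reflectionInvariant q c x y z)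
  Λ⇒reflectionInvariant (scaleΛ a p)  c x y z = *-congˡ (Λ⇒reflectionInvariant p c x y z)
  Λ⇒reflectionInvariant (A1 {v} p)    c x y z =
    neighbourSum-reflect c x (λ x′ → v x′ y z) (λ x′ → v x′ (reflect c y) (reflect c z))
      (λ x′ → Λ⇒reflectionInvariant p c x′ y z)
  Λ⇒reflectionInvariant (A2 {v} p)    c x y z =
    neighbourSum-reflect c y (λ y′ → v x y′ z) (λ y′ → v (reflect c x) y′ (reflect c z))
      (λ y′ → Λ⇒reflectionInvariant p c x y′ z)
  Λ⇒reflectionInvariant (A3 {v} p)    c x y z =
    neighbourSum-reflect c z (v x y) (v (reflect c x) (reflect c y))
      (λ z′ → Λ⇒reflectionInvariant p c x y z′)
  Λ⇒reflectionInvariant (A*1 p)       c x y z = *-cong (θ*-dist-reflect c y z) (Λ⇒reflectionInvariant p c x y z)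
  Λ⇒reflectionInvariant (A*2 p)       c x y z = *-cong (θ*-dist-reflect c x z) (Λ⇒reflectionInvariant p c x y z)
  Λ⇒reflectionInvariant (A*3 p)       c x y z = *-cong (θ*-dist-reflect c x y) (Λ⇒reflectionInvariant p c x y z)
  Λ⇒reflectionInvariant (respΛ u≋v p) c x y z =
    trans (sym (u≋v x y z)) (trans (Λ⇒reflectionInvariant p c x y z) (u≋v _ _ _))

  ReflectionInvariant₂ : (X → X → Carrier) → Set ℓ₂
  ReflectionInvariant₂ G = ∀ c p q → G p q ≈ G (reflect c p) (reflect c q)

  -- Reflecting in b moves (a , b) to (s , 0) with toℕ s = residue b a; when that residue exceeds
  -- N/2, reflecting in 0 replaces it by N − residue b a.
  reflectionInvariant₂-reduce : ∀ {G} → ReflectionInvariant₂ G →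
                                ∀ {a b t} → toℕ t ≡ dist a b → G a b ≈ G t Fin.zero
  reflectionInvariant₂-reduce {G} G-inv {a} {b} {t} t≡dist =
    trans (G-inv b a b) (trans (reflexive (≡.cong (G s) (reflect-self b)))
      (toOrigin (ℕₚ.≤-total r (N ∸ r))))
    where
      s = reflect b a
      r = residue b a
      toℕt≡ : toℕ t ≡ r ⊓ (N ∸ r)
      toℕt≡ = ≡.trans t≡dist (dist-sym a b)
      toOrigin : r ≤ N ∸ r ⊎ N ∸ r ≤ r → G s Fin.zero ≈ G t Fin.zero
      toOrigin (inj₁ r≤N∸r) = reflexive (≡.cong (λ p → G p Fin.zero)
        (toℕ-injective (≡.trans (toℕ-reflect b a) (≡.sym (≡.trans toℕt≡ (ℕₚ.m≤n⇒m⊓n≡m r≤N∸r))))))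
      toOrigin (inj₂ N∸r≤r) =
        trans (G-inv Fin.zero s Fin.zero) (reflexive (≡.cong₂ G s′≡t (reflect-self Fin.zero)))
        where
          s≢0 : s ≢ Fin.zero
          s≢0 s≡0 = contradiction (≡.subst (λ k → N ∸ k ≤ k) r≡0 N∸r≤r) λ ()
            where r≡0 = ≡.trans (≡.sym (toℕ-reflect b a)) (≡.cong toℕ s≡0)
          s′≡t : reflect Fin.zero s ≡ t
          s′≡t = toℕ-injective (≡.trans (toℕ-reflect-zero s≢0) (≡.trans (≡.cong (N ∸_) (toℕ-reflect b a))
                   (≡.sym (≡.trans toℕt≡ (ℕₚ.m≥n⇒m⊓n≡n N∸r≤r)))))

  ind-∧ : ∀ a b → ind (a ∧ b) ≈ ind a * ind b
  ind-∧ true  b = sym (*-identityˡ _)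
  ind-∧ false b = sym (zeroˡ _)

  P-slice₁ : ∀ i x y z → P 0 i i x y z ≈ ind (toℕ y ≡ᵇ toℕ z) * ind (dist x y ≡ᵇ i)
  P-slice₁ i x y z = trans (reflexive (≡.cong ind (slice y z (y Fin.≟ z)))) (ind-∧ _ _)
    where
      slice : ∀ y z → Dec (y ≡ z) →
              (dist y z ≡ᵇ 0) ∧ (dist x z ≡ᵇ i) ∧ (dist x y ≡ᵇ i) ≡ (toℕ y ≡ᵇ toℕ z) ∧ (dist x y ≡ᵇ i)
      slice y .y (yes ≡.refl) = ≡.cong₂ _∧_ (≡.trans (≡.cong (_≡ᵇ 0) (dist-refl y)) (≡.sym (≡ᵇ-refl (toℕ y))))
                                             (∧-idem (dist x y ≡ᵇ i))
      slice y z (no y≢z) = ≡.trans (≡.cong (_∧ ((dist x z ≡ᵇ i) ∧ (dist x y ≡ᵇ i))) (≢⇒dist≡ᵇ0-false y≢z))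
                                   (≡.sym (≡.cong (_∧ (dist x y ≡ᵇ i)) (≢⇒toℕ≡ᵇ-false y≢z)))

  P-slice₂ : ∀ i x y z → P i 0 i x y z ≈ ind (toℕ x ≡ᵇ toℕ z) * ind (dist x y ≡ᵇ i)
  P-slice₂ i x y z = trans (reflexive (≡.cong ind (slice x z (x Fin.≟ z)))) (ind-∧ _ _)
    where
      slice : ∀ x z → Dec (x ≡ z) →
              (dist y z ≡ᵇ i) ∧ (dist x z ≡ᵇ 0) ∧ (dist x y ≡ᵇ i) ≡ (toℕ x ≡ᵇ toℕ z) ∧ (dist x y ≡ᵇ i)
      slice x .x (yes ≡.refl) = ≡.trans
        (≡.cong₂ (λ a e → a ∧ e ∧ (dist x y ≡ᵇ i)) (≡.cong (_≡ᵇ i) (dist-sym y x)) (≡.cong (_≡ᵇ 0) (dist-refl x)))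
        (≡.trans (∧-idem (dist x y ≡ᵇ i)) (≡.sym (≡.cong (_∧ (dist x y ≡ᵇ i)) (≡ᵇ-refl (toℕ x)))))
      slice x z (no x≢z) = ≡.trans
        (≡.cong (λ e → (dist y z ≡ᵇ i) ∧ e ∧ (dist x y ≡ᵇ i)) (≢⇒dist≡ᵇ0-false x≢z))
        (≡.trans (∧-zeroʳ (dist y z ≡ᵇ i)) (≡.sym (≡.cong (_∧ (dist x y ≡ᵇ i)) (≢⇒toℕ≡ᵇ-false x≢z))))

  P-slice₃ : ∀ i x y z → P i i 0 x y z ≈ ind (toℕ x ≡ᵇ toℕ y) * ind (dist y z ≡ᵇ i)
  P-slice₃ i x y z = trans (reflexive (≡.cong ind (slice x y (x Fin.≟ y)))) (ind-∧ _ _)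
    where
      slice : ∀ x y → Dec (x ≡ y) →
              (dist y z ≡ᵇ i) ∧ (dist x z ≡ᵇ i) ∧ (dist x y ≡ᵇ 0) ≡ (toℕ x ≡ᵇ toℕ y) ∧ (dist y z ≡ᵇ i)
      slice x .x (yes ≡.refl) = ≡.trans
        (≡.cong (λ e → (dist x z ≡ᵇ i) ∧ (dist x z ≡ᵇ i) ∧ e) (≡.cong (_≡ᵇ 0) (dist-refl x)))
        (≡.trans (≡.cong ((dist x z ≡ᵇ i) ∧_) (∧-identityʳ (dist x z ≡ᵇ i)))
        (≡.trans (∧-idem (dist x z ≡ᵇ i)) (≡.sym (≡.cong (_∧ (dist x z ≡ᵇ i)) (≡ᵇ-refl (toℕ x))))))
      slice x y (no x≢y) = ≡.trans
        (≡.cong (λ e → (dist y z ≡ᵇ i) ∧ (dist x z ≡ᵇ i) ∧ e) (≢⇒dist≡ᵇ0-false x≢y))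
        (≡.trans (≡.cong ((dist y z ≡ᵇ i) ∧_) (∧-zeroʳ (dist x z ≡ᵇ i)))
        (≡.trans (∧-zeroʳ (dist y z ≡ᵇ i)) (≡.sym (≡.cong (_∧ (dist y z ≡ᵇ i)) (≢⇒toℕ≡ᵇ-false x≢y)))))

  module _ (h : X → X → X → Carrier) where

    vanishingVec : List Carrier → V³
    vanishingVec []       = 𝟙³
    vanishingVec (r ∷ rs) = (λ x y z → h x y z * vanishingVec rs x y z) +v ((- r) ·v vanishingVec rs)

    vanishingVec∈Λ : (∀ {w} → Λ w → Λ (λ x y z → h x y z * w x y z)) → ∀ rs → Λ (vanishingVec rs)
    vanishingVec∈Λ Λ-*h []       = gen
    vanishingVec∈Λ Λ-*h (r ∷ rs) =
      addΛ (Λ-*h (vanishingVec∈Λ Λ-*h rs)) (scaleΛ (- r) (vanishingVec∈Λ Λ-*h rs))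

    vanishingVec-value : ∀ rs x y z → vanishingVec rs x y z ≈ vanishing rs (h x y z)
    vanishingVec-value []       x y z = refl
    vanishingVec-value (r ∷ rs) x y z =
      trans (sym (distribʳ (vanishingVec rs x y z) (h x y z) (- r))) (*-congˡ (vanishingVec-value rs x y z))

module DualEigenvalues {ℓ₁ ℓ₂ : Level} (R : CommutativeRing ℓ₁ ℓ₂) (isField : IsField R)
                       (n : ℕ) (ζ : CommutativeRing.Carrier R) (ζ-primitive : IsPrimitiveRoot R (suc n) ζ) where
  open CommutativeRing R hiding (zero)
  open Cycle R (suc n) ζ using (θ*)
  open CycleArithmetic R n ζ using (N)
  open RingFacts R using (pow-+; [a-b][1-s]≈[a+sb]-[b+sa])
  open FieldFacts R isField using (*-≉0)
  open import Algebra.Properties.Group +-group using (x∙y⁻¹≈ε⇒x≈y; x≈y⇒x∙y⁻¹≈ε)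
  open import Relation.Binary.Reasoning.Setoid setoid
  open ℕₚ using (≤-trans; <-≤-trans; ≤-<-trans; <⇒≤)

  private
    ζ^ : ℕ → Carrier
    ζ^ = pow R ζ

  ζ^-cancelˡ : ∀ {i} k → i ≤ N → ζ^ i ≈ ζ^ i * ζ^ k → ζ^ k ≈ 1#
  ζ^-cancelˡ {i} k i≤N ζⁱ≈ζⁱζᵏ = begin
      ζ^ k                          ≈⟨ sym (*-identityˡ _) ⟩
      1# * ζ^ k                     ≈⟨ *-congʳ (sym ζ⁻ⁱζⁱ≈1) ⟩
      (ζ^ (N ∸ i) * ζ^ i) * ζ^ k    ≈⟨ *-assoc _ _ _ ⟩
      ζ^ (N ∸ i) * (ζ^ i * ζ^ k)    ≈⟨ *-congˡ (sym ζⁱ≈ζⁱζᵏ) ⟩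
      ζ^ (N ∸ i) * ζ^ i             ≈⟨ ζ⁻ⁱζⁱ≈1 ⟩
      1#                            ∎
    where
      ζ⁻ⁱζⁱ≈1 : ζ^ (N ∸ i) * ζ^ i ≈ 1#
      ζ⁻ⁱζⁱ≈1 = trans (sym (pow-+ ζ (N ∸ i) i))
                      (trans (reflexive (≡.cong ζ^ (ℕₚ.m∸n+n≡m i≤N))) (proj₁ ζ-primitive))

  θ*-split : ∀ i j → i ℕ.+ j ≤ N → θ* i ≈ ζ^ i + ζ^ (N ∸ (i ℕ.+ j)) * ζ^ j
  θ*-split i j i+j≤N = +-congˡ (trans (reflexive (≡.cong ζ^ N∸i≡)) (pow-+ ζ (N ∸ (i ℕ.+ j)) j))
    where
      N∸i≡ : N ∸ i ≡ N ∸ (i ℕ.+ j) ℕ.+ j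
      N∸i≡ = ≡.trans (≡.sym (ℕₚ.m∸n+n≡m (ℕₚ.m+n≤o⇒m≤o∸n j (≡.subst (_≤ N) (ℕₚ.+-comm i j) i+j≤N))))
                     (≡.cong (ℕ._+ j) (ℕₚ.∸-+-assoc N i j))

  θ*-<-distinct : ∀ {i j} → i < j → i ℕ.+ j < N → ¬ θ* i - θ* j ≈ 0#
  θ*-<-distinct {i} {j} i<j i+j<N θ*ᵢ-θ*ⱼ≈0 = *-≉0 a-b≉0 1-s≉0 (begin
      (a - b) * (1# - s)        ≈⟨ [a-b][1-s]≈[a+sb]-[b+sa] a b s ⟩
      (a + s * b) - (b + s * a) ≈⟨ +-cong (sym (θ*-split i j i+j≤N)) (-‿cong (sym θ*ⱼ≈b+sa)) ⟩
      θ* i - θ* j               ≈⟨ θ*ᵢ-θ*ⱼ≈0 ⟩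
      0#                        ∎)
    where
      i+j≤N = <⇒≤ i+j<N
      j<N : j < N
      j<N = ≤-<-trans (ℕₚ.m≤n+m j i) i+j<N
      a = ζ^ i
      b = ζ^ j
      s = ζ^ (N ∸ (i ℕ.+ j))
      θ*ⱼ≈b+sa : θ* j ≈ b + s * a
      θ*ⱼ≈b+sa = trans (θ*-split j i (≡.subst (_≤ N) (ℕₚ.+-comm i j) i+j≤N))
                       (reflexive (≡.cong (λ m → b + ζ^ (N ∸ m) * a) (ℕₚ.+-comm j i)))
      a-b≉0 : ¬ a - b ≈ 0#
      a-b≉0 a-b≈0 = proj₂ ζ-primitive (j ∸ i) (ℕₚ.m<n⇒0<n∸m i<j) (≤-<-trans (ℕₚ.m∸n≤m j i) j<N)
        (ζ^-cancelˡ (j ∸ i) (<⇒≤ (ℕₚ.<-trans i<j j<N)) (trans (x∙y⁻¹≈ε⇒x≈y a b a-b≈0)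
          (trans (reflexive (≡.cong ζ^ (≡.sym (ℕₚ.m+[n∸m]≡n (<⇒≤ i<j))))) (pow-+ ζ i (j ∸ i)))))
      1-s≉0 : ¬ 1# - s ≈ 0#
      1-s≉0 1-s≈0 = proj₂ ζ-primitive (N ∸ (i ℕ.+ j)) (ℕₚ.m<n⇒0<n∸m i+j<N)
        (ℕₚ.∸-monoʳ-< (<-≤-trans (≤-<-trans z≤n i<j) (ℕₚ.m≤n+m j i)) i+j≤N)
        (sym (x∙y⁻¹≈ε⇒x≈y 1# s 1-s≈0))

  private
    k<l≤D⇒k+l<N : ∀ {D k l} → D ℕ.+ D ≤ N → k < l → l ≤ D → k ℕ.+ l < N
    k<l≤D⇒k+l<N 2D≤N k<l l≤D = <-≤-trans (ℕₚ.+-monoˡ-< _ k<l) (≤-trans (ℕₚ.+-mono-≤ l≤D l≤D) 2D≤N)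

  θ*-distinct : ∀ {D i j} → D ℕ.+ D ≤ N → i ≤ D → j ≤ D → i ≢ j → ¬ θ* i - θ* j ≈ 0#
  θ*-distinct {D} {i} {j} 2D≤N i≤D j≤D i≢j with ℕₚ.<-cmp i j
  ... | tri< i<j _ _ = θ*-<-distinct i<j (k<l≤D⇒k+l<N 2D≤N i<j j≤D)
  ... | tri≈ _ i≡j _ = contradiction i≡j i≢j
  ... | tri> _ _ j<i = θ*-<-distinct j<i (k<l≤D⇒k+l<N 2D≤N j<i i≤D)
                       ∘ (λ θ*ᵢ-θ*ⱼ≈0 → x≈y⇒x∙y⁻¹≈ε (sym (x∙y⁻¹≈ε⇒x≈y _ _ θ*ᵢ-θ*ⱼ≈0)))

module DiagonalSlices {ℓ₁ ℓ₂ : Level} (R : CommutativeRing ℓ₁ ℓ₂) (isField : IsField R)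
                      (n : ℕ) (ζ : CommutativeRing.Carrier R) (ζ-primitive : IsPrimitiveRoot R (suc n) ζ)
                      (D : ℕ) (2D≤N : D ℕ.+ D ≤ suc n) (N≤2D+1 : suc n ≤ suc (D ℕ.+ D)) where
  open CommutativeRing R hiding (zero)
  open Cycle R (suc n) ζ
  open CycleArithmetic R n ζ
  open FundamentalModule R n ζ
  open RingFacts R using (vanishing; vanishing-root)
  open FieldFacts R isField using (vanishing-≉0)
  open DualEigenvalues R isField n ζ ζ-primitive using (θ*-distinct)
  open import Relation.Binary.Reasoning.Setoid setoid

  levelSet : (X → X → X → ℕ) → ℕ → V³
  levelSet g i x y z = ind (g x y z ≡ᵇ i)

  -- levelSet g i = c · ∏ (θ*(g) − θ*_k) over k ≤ D, k ≠ i, where c⁻¹ = ∏ (θ*_i − θ*_k).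
  closed⇒levelSet∈Λ : ∀ g → (∀ x y z → g x y z ≤ D) →
                      (∀ {w} → Λ w → Λ (λ x y z → θ* (g x y z) * w x y z)) →
                      ∀ i → i ≤ D → Λ (levelSet g i)
  closed⇒levelSet∈Λ g g≤D Λ-*θ*g i i≤D =
    respΛ (λ x y z → trans (*-congˡ (vanishingVec-value h roots x y z))
                           (normalise (g x y z) (g≤D x y z)))
          (scaleΛ c (vanishingVec∈Λ h Λ-*θ*g roots))
    where
      h = λ x y z → θ* (g x y z)
      ≢i? = λ k → ¬? (k ℕₚ.≟ i)
      others = filter ≢i? (upTo (suc D))
      roots = map θ* others
      θ*ᵢ-root≉0 : ∀ {r} → r ∈ roots → ¬ θ* i - r ≈ 0#
      θ*ᵢ-root≉0 r∈roots with k , k∈others , ≡.refl ← ∈-map⁻ θ* r∈roots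
                          with k<1+D , k≢i ← ∈-filter⁻ ≢i? k∈others
        = θ*-distinct 2D≤N i≤D (ℕₚ.≤-pred (∈-upTo⁻ k<1+D)) (k≢i ∘ ≡.sym)
      inverse = proj₂ isField (vanishing roots (θ* i)) (vanishing-≉0 roots θ*ᵢ-root≉0)
      c = proj₁ inverse
      normalise : ∀ d → d ≤ D → c * vanishing roots (θ* d) ≈ ind (d ≡ᵇ i)
      normalise d d≤D with d ℕₚ.≟ i
      ... | yes ≡.refl rewrite ≡ᵇ-refl d = trans (*-comm _ _) (proj₂ inverse)
      ... | no d≢i rewrite ≢⇒≡ᵇ-false d≢i =
        trans (*-congˡ (vanishing-root (∈-map⁺ θ* (∈-filter⁺ ≢i? (∈-upTo⁺ (s≤s d≤D)) d≢i)))) (zeroʳ c)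

  _at_ : ∀ {a} {A : Set a} → (X → X → X → A) → X × X × X → A
  f at p = f (proj₁ p) (proj₁ (proj₂ p)) (proj₂ (proj₂ p))

  record DiagonalSlice (E : V³ → V³) (b : Fin (suc D) → V³) : Set (ℓ₁ ⊔ ℓ₂) where
    field
      onDiagonal     : X → X → X → Bool
      E-def          : ∀ v x y z → E v x y z ≡ ind (onDiagonal x y z) * v x y z
      level          : X → X → X → ℕ
      level≤D        : ∀ x y z → level x y z ≤ D
      levelSet∈Λ     : ∀ i → i ≤ D → Λ (levelSet level i)
      b-def          : ∀ k x y z → b k x y z ≈ ind (onDiagonal x y z) * ind (level x y z ≡ᵇ toℕ k)
      rep            : Fin (suc D) → X × X × X
      rep-onDiagonal : ∀ k → onDiagonal at rep k ≡ true
      rep-level      : ∀ k → level at rep k ≡ toℕ k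
      Λ-levelwise    : ∀ {u} → Λ u → ∀ k x y z → onDiagonal x y z ≡ true → level x y z ≡ toℕ k →
                       u x y z ≈ u at rep k

  module _ {E b} (S : DiagonalSlice E b) where
    open DiagonalSlice S

    private
      E-onDiagonal : ∀ v {x y z} → onDiagonal x y z ≡ true → E v x y z ≈ v x y z
      E-onDiagonal v {x} {y} {z} on rewrite E-def v x y z | on = *-identityˡ _

      E-offDiagonal : ∀ v {x y z} → onDiagonal x y z ≡ false → E v x y z ≈ 0#
      E-offDiagonal v {x} {y} {z} off rewrite E-def v x y z | off = zeroˡ _

      lincomb-onDiagonal : ∀ a {x y z} k → onDiagonal x y z ≡ true → level x y z ≡ toℕ k →
                           lincomb (suc D) a b x y z ≈ a k
      lincomb-onDiagonal a {x} {y} {z} k on lvl = lincomb-δ a b x y z k λ j → trans (b-def j x y z)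
        (trans (reflexive (≡.cong₂ (λ o l → ind o * ind (l ≡ᵇ toℕ j)) on lvl)) (*-identityˡ _))

      lincomb-offDiagonal : ∀ a {x y z} → onDiagonal x y z ≡ false → lincomb (suc D) a b x y z ≈ 0#
      lincomb-offDiagonal a {x} {y} {z} off = lincomb-zero a b x y z λ j → trans (b-def j x y z)
        (trans (reflexive (≡.cong (λ o → ind o * _) off)) (zeroˡ _))

    diagonalSlice⇒isBasis : IsBasis (imageΛ E) (suc D) b
    diagonalSlice⇒isBasis = member , independent , spanning
      where
        member : ∀ k → imageΛ E (b k)
        member k = levelSet level (toℕ k) , levelSet∈Λ (toℕ k) (ℕₚ.≤-pred (toℕ<n k)) ,
                   λ x y z → trans (b-def k x y z) (reflexive (≡.sym (E-def _ x y z)))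

        independent : ∀ a → lincomb (suc D) a b ≋ 0v → ∀ k → a k ≈ 0#
        independent a a·b≈0 k =
          trans (sym (lincomb-onDiagonal a k (rep-onDiagonal k) (rep-level k))) (a·b≈0 _ _ _)

        spanning : ∀ w → imageΛ E w → Σ (Fin (suc D) → Carrier) (λ a → w ≋ lincomb (suc D) a b)
        spanning w (u , u∈Λ , w≋Eu) = (u at_) ∘ rep , expand
          where
            expand : w ≋ lincomb (suc D) ((u at_) ∘ rep) b
            expand x y z with onDiagonal x y z in on
            ... | false =
              trans (w≋Eu x y z) (trans (E-offDiagonal u on) (sym (lincomb-offDiagonal ((u at_) ∘ rep) on)))
            ... | true  = begin
                w x y z                                 ≈⟨ w≋Eu x y z ⟩
                E u x y z                               ≈⟨ E-onDiagonal u on ⟩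
                u x y z                                 ≈⟨ Λ-levelwise u∈Λ k x y z on lvl ⟩
                u at rep k                              ≈⟨ sym (lincomb-onDiagonal ((u at_) ∘ rep) k on lvl) ⟩
                lincomb (suc D) ((u at_) ∘ rep) b x y z ∎
              where
                k = fromℕ< (s≤s (level≤D x y z))
                lvl = ≡.sym (toℕ-fromℕ< (s≤s (level≤D x y z)))

  vertex : Fin (suc D) → X
  vertex k = inject≤ k (s≤s (m+m≤1+n⇒m≤n D 2D≤N))

  toℕ-vertex : ∀ k → toℕ (vertex k) ≡ toℕ k
  toℕ-vertex k = toℕ-inject≤ k _

  dist-vertex-zero : ∀ k → dist (vertex k) Fin.zero ≡ toℕ k
  dist-vertex-zero k = ≡.trans (dist-zeroʳ (vertex k) 2k≤N) (toℕ-vertex k)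
    where
      k≤D = ℕₚ.≤-pred (toℕ<n k)
      2k≤N = ≡.subst (λ m → m ℕ.+ m ≤ N) (≡.sym (toℕ-vertex k))
                     (ℕₚ.≤-trans (ℕₚ.+-mono-≤ k≤D k≤D) 2D≤N)

  dist-zero-vertex : ∀ k → dist Fin.zero (vertex k) ≡ toℕ k
  dist-zero-vertex k = ≡.trans (dist-sym Fin.zero (vertex k)) (dist-vertex-zero k)

  dist≤D : ∀ x y → dist x y ≤ D
  dist≤D = dist≤ N≤2D+1

  Λ-levelwise₁ : ∀ {u} → Λ u → ∀ k x y z → (toℕ y ≡ᵇ toℕ z) ≡ true → dist x y ≡ toℕ k →
                 u x y z ≈ u (vertex k) Fin.zero Fin.zero
  Λ-levelwise₁ u∈Λ k x y z y=z d≡k with ≡.refl ← toℕ≡ᵇ-true⇒≡ {x = y} {z} y=z =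
    reflectionInvariant₂-reduce (λ c p q → Λ⇒reflectionInvariant u∈Λ c p q q)
      (≡.trans (toℕ-vertex k) (≡.sym d≡k))

  Λ-levelwise₂ : ∀ {u} → Λ u → ∀ k x y z → (toℕ x ≡ᵇ toℕ z) ≡ true → dist x y ≡ toℕ k →
                 u x y z ≈ u Fin.zero (vertex k) Fin.zero
  Λ-levelwise₂ u∈Λ k x y z x=z d≡k with ≡.refl ← toℕ≡ᵇ-true⇒≡ {x = x} {z} x=z =
    reflectionInvariant₂-reduce (λ c p q → Λ⇒reflectionInvariant u∈Λ c q p q)
      (≡.trans (toℕ-vertex k) (≡.trans (≡.sym d≡k) (dist-sym x y)))

  Λ-levelwise₃ : ∀ {u} → Λ u → ∀ k x y z → (toℕ x ≡ᵇ toℕ y) ≡ true → dist y z ≡ toℕ k →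
                 u x y z ≈ u Fin.zero Fin.zero (vertex k)
  Λ-levelwise₃ u∈Λ k x y z x=y d≡k with ≡.refl ← toℕ≡ᵇ-true⇒≡ {x = x} {y} x=y =
    reflectionInvariant₂-reduce (λ c p q → Λ⇒reflectionInvariant u∈Λ c q q p)
      (≡.trans (toℕ-vertex k) (≡.trans (≡.sym d≡k) (dist-sym x z)))

  slice₁ : DiagonalSlice E₀*⁽¹⁾ (λ k → P 0 (toℕ k) (toℕ k))
  slice₁ = record
    { onDiagonal     = λ x y z → toℕ y ≡ᵇ toℕ z
    ; E-def          = λ _ _ _ _ → ≡.refl
    ; level          = λ x y z → dist x y
    ; level≤D        = λ x y z → dist≤D x y
    ; levelSet∈Λ     = closed⇒levelSet∈Λ (λ x y z → dist x y) (λ x y z → dist≤D x y) A*3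
    ; b-def          = λ k → P-slice₁ (toℕ k)
    ; rep            = λ k → vertex k , Fin.zero , Fin.zero
    ; rep-onDiagonal = λ _ → ≡.refl
    ; rep-level      = dist-vertex-zero
    ; Λ-levelwise    = Λ-levelwise₁
    }

  slice₂ : DiagonalSlice E₀*⁽²⁾ (λ k → P (toℕ k) 0 (toℕ k))
  slice₂ = record
    { onDiagonal     = λ x y z → toℕ x ≡ᵇ toℕ z
    ; E-def          = λ _ _ _ _ → ≡.refl
    ; level          = λ x y z → dist x y
    ; level≤D        = λ x y z → dist≤D x y
    ; levelSet∈Λ     = closed⇒levelSet∈Λ (λ x y z → dist x y) (λ x y z → dist≤D x y) A*3
    ; b-def          = λ k → P-slice₂ (toℕ k)
    ; rep            = λ k → Fin.zero , vertex k , Fin.zero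
    ; rep-onDiagonal = λ _ → ≡.refl
    ; rep-level      = dist-zero-vertex
    ; Λ-levelwise    = Λ-levelwise₂
    }

  slice₃ : DiagonalSlice E₀*⁽³⁾ (λ k → P (toℕ k) (toℕ k) 0)
  slice₃ = record
    { onDiagonal     = λ x y z → toℕ x ≡ᵇ toℕ y
    ; E-def          = λ _ _ _ _ → ≡.refl
    ; level          = λ x y z → dist y z
    ; level≤D        = λ x y z → dist≤D y z
    ; levelSet∈Λ     = closed⇒levelSet∈Λ (λ x y z → dist y z) (λ x y z → dist≤D y z) A*1
    ; b-def          = λ k → P-slice₃ (toℕ k)
    ; rep            = λ k → Fin.zero , Fin.zero , vertex k
    ; rep-onDiagonal = λ _ → ≡.refl
    ; rep-level      = dist-zero-vertex
    ; Λ-levelwise    = Λ-levelwise₃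
    }

open import Data.Nat.Base using (_*_)

2*n≡n+n : ∀ n → 2 * n ≡ n ℕ.+ n
2*n≡n+n n = ≡.cong (n ℕ.+_) (ℕₚ.+-identityʳ n)

half-bounds : ∀ {N} D → N ≡ 2 * D ⊎ N ≡ suc (2 * D) → D ℕ.+ D ≤ N × N ≤ suc (D ℕ.+ D)
half-bounds D (inj₁ ≡.refl) =
  ℕₚ.≤-reflexive (≡.sym (2*n≡n+n D)) , ℕₚ.m≤n⇒m≤1+n (ℕₚ.≤-reflexive (2*n≡n+n D))
half-bounds D (inj₂ ≡.refl) =
  ℕₚ.m≤n⇒m≤1+n (ℕₚ.≤-reflexive (≡.sym (2*n≡n+n D))) , s≤s (ℕₚ.≤-reflexive (2*n≡n+n D))

lemma10p3 : ∀ {c ℓ : Level} (R : CommutativeRing c ℓ) → IsField R → CharZero R →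
    (D N : ℕ) → 2 ≤ D → (N ≡ 2 * D ⊎ N ≡ suc (2 * D)) →
    (ζ : CommutativeRing.Carrier R) → IsPrimitiveRoot R N ζ →
    let open Cycle R N ζ in
      IsBasis (imageΛ E₀*⁽¹⁾) (suc D) (λ i → P 0 (toℕ i) (toℕ i))
      × IsBasis (imageΛ E₀*⁽²⁾) (suc D) (λ i → P (toℕ i) 0 (toℕ i))
      × IsBasis (imageΛ E₀*⁽³⁾) (suc D) (λ i → P (toℕ i) (toℕ i) 0)
lemma10p3 R isField _ D (suc n) _ N≡2D⊎2D+1 ζ ζ-primitive =
  diagonalSlice⇒isBasis slice₁ , diagonalSlice⇒isBasis slice₂ , diagonalSlice⇒isBasis slice₃
  where
    bounds = half-bounds D N≡2D⊎2D+1
    open DiagonalSlices R isField n ζ ζ-primitive D (proj₁ bounds) (proj₂ bounds)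
lemma10p3 _ _ _ (suc (suc _)) zero (s≤s (s≤s z≤n)) (inj₁ ()) _ _
lemma10p3 _ _ _ (suc (suc _)) zero (s≤s (s≤s z≤n)) (inj₂ ()) _ _
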